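{- Let $\mathbf{s}=(s_1,\dots,s_n)$ be a sequence of positive integers and $\mathbf{u}=(s_n,\dots,s_1)$ its reverse. For every $\mathbf{r}\in\Psi_n$, \[\operatorname{des}_{\mathbf{s}^*}(\mathbf{r},0)=\operatorname{des}_{\mathbf{u}^*}\big(\operatorname{reverse}(\Phi_{\mathbf{s}}(\mathbf{r})),0\big).\]
   Context: $\langle N\rangle=\{0,\dots,N\}$, $\Psi_n=\langle s_1-1\rangle\times\cdots\times\langle s_n-1\rangle$. $\mathbf{s}^*=(s_1,\dots,s_n,1)$, $\mathbf{u}^*=(s_n,\dots,s_1,1)$. $\operatorname{reverse}$ reverses a sequence. $\Phi_{\mathbf{s}}:\Psi_n\to\Psi_n$ sends $(r_1,\dots,r_n)$ to $(z_1,\dots,z_n)$ where $z_i\in\langle s_i-1\rangle$ and $r_i+z_i\equiv 0\pmod{s_i}$. For a sequence $\mathbf{t}=(t_1,\dots,t_m)$ of positive integers and $\mathbf{r}\in\mathbb{N}^m$, $\operatorname{des}_{\mathbf{t}}(\mathbf{r})=\#\{i\in\{1,\dots,m-1\}: r_i/t_i>r_{i+1}/t_{i+1}\}$; here $(\mathbf{r},0)$ denotes the sequence of length $n+1$ obtained by appending $0$. -}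

module Defs where

open import Data.Nat using (ℕ; zero; suc; _+_; _*_; _∸_; _<_; _<ᵇ_)
open import Data.Nat.DivMod using (_%_)
open import Data.Bool using (Bool; true; false; if_then_else_)
open import Data.Vec using (Vec; []; _∷_; zipWith; reverse; _∷ʳ_)
open import Data.Vec.Relation.Unary.All using (All)
open import Data.Vec.Relation.Binary.Pointwise.Inductive using (Pointwise)

-- A sequence of length m of naturals given as Vec ℕ m.
-- Ψ-membership: r ∈ Ψ_n  iff  r_i ∈ ⟨s_i - 1⟩, i.e. r_i < s_i for all i.
InΨ : ∀ {n} → Vec ℕ n → Vec ℕ n → Set
InΨ s r = Pointwise _<_ r s

Positive : ∀ {n} → Vec ℕ n → Set
Positive s = All (0 <_) s

-- The unique z ∈ ⟨s-1⟩ with r + z ≡ 0 (mod s), for s > 0.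
-- (The value for s = 0 is irrelevant: excluded by hypothesis.)
negMod : ℕ → ℕ → ℕ
negMod r zero    = 0
negMod r (suc k) = (suc k ∸ (r % suc k)) % suc k

Φ : ∀ {n} → Vec ℕ n → Vec ℕ n → Vec ℕ n
Φ s r = zipWith negMod r s

-- Fraction comparison a/b > c/d for positive b, d, via cross multiplication:
-- a/b > c/d  ⇔  a*d > c*b.
fracGt : ℕ → ℕ → ℕ → ℕ → Bool
fracGt a b c d = (c * b) <ᵇ (a * d)

des : ∀ {m} → Vec ℕ m → Vec ℕ m → ℕ
des (t ∷ t' ∷ ts) (r ∷ r' ∷ rs) =
  (if fracGt r t r' t' then 1 else 0) + des (t' ∷ ts) (r' ∷ rs)
des _ _ = 0

star : ∀ {n} → Vec ℕ n → Vec ℕ (suc n)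
star s = s ∷ʳ 1

app0 : ∀ {n} → Vec ℕ n → Vec ℕ (suc n)
app0 r = r ∷ʳ 0

module Submission where

-- Write zᵢ = Φ_s(r)ᵢ.  The proof rests on a local exchange identity between
-- neighbouring positions i, i+1:
--
--   [rᵢ/sᵢ > rᵢ₊₁/sᵢ₊₁] + [zᵢ₊₁ > 0]  =  [zᵢ > 0] + [zᵢ₊₁/sᵢ₊₁ > zᵢ/sᵢ].
--
-- It holds because rᵢ and zᵢ are "complements" in ⟨sᵢ-1⟩: either both are 0,
-- or both are positive with rᵢ + zᵢ = sᵢ, in which case zᵢ/sᵢ = 1 - rᵢ/sᵢ and
-- comparing z-fractions is comparing r-fractions the other way round.
--
-- It then introduces  ascents  (descents read from right to
-- left), shows  des (reverse t) (reverse r) = ascents t r, and rewrites the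
-- right-hand side of the theorem as  ascents (1 ∷ s) (0 ∷ z).  Summing the
-- exchange identity over i (a telescoping induction on s) shows this equals
-- the left-hand side  des (star s) (app0 r), which is the theorem.

open import Defs
open import Data.Bool using (Bool; if_then_else_; T)
open import Data.Bool.Properties using (T-≡; ⇔→≡)
open import Data.Nat using (ℕ; zero; suc; _+_; _*_; _∸_; _<_; _<ᵇ_; z<s; s≤s; z≤n)
open import Data.Nat.Properties
open import Data.Nat.DivMod using (m<n⇒m%n≡m; n%n≡0)
open import Data.Vec using (Vec; []; _∷_; reverse; _∷ʳ_)
open import Data.Vec.Properties using (reverse-∷)
open import Data.Vec.Relation.Binary.Pointwise.Inductive using ([]; _∷_)
open import Function.Bundles using (_⇔_; mk⇔)
open import Function.Construct.Composition using (_⇔-∘_)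
open import Function.Construct.Symmetry using (⇔-sym)
open import Relation.Binary.PropositionalEquality using (_≡_; refl; sym; trans; cong; cong₂; subst; module ≡-Reasoning)

open ≡-Reasoning

indicator : Bool → ℕ
indicator b = if b then 1 else 0

<ᵇ-cong : ∀ {m n p q} → (m < n ⇔ p < q) → (m <ᵇ n) ≡ (p <ᵇ q)
<ᵇ-cong {m} {n} {p} {q} m<n⇔p<q =
  ⇔→≡ (T-≡ ⇔-∘ (⇔-sym (T<ᵇ⇔< p q) ⇔-∘ (m<n⇔p<q ⇔-∘ (T<ᵇ⇔< m n ⇔-∘ ⇔-sym T-≡))))
  where
  T<ᵇ⇔< : ∀ a b → T (a <ᵇ b) ⇔ a < b
  T<ᵇ⇔< a b = mk⇔ (<ᵇ⇒< a b) <⇒<ᵇ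

+-trade-< : ∀ {x y x′ y′} → x + y ≡ x′ + y′ → (y < y′ ⇔ x′ < x)
+-trade-< e = mk⇔
  (λ y<y′ → ≰⇒> (λ x≤x′ → <-irrefl e (+-mono-≤-< x≤x′ y<y′)))
  (λ x′<x → ≰⇒> (λ y′≤y → <-irrefl (sym e) (+-mono-<-≤ x′<x y′≤y)))

fracGt-complement : ∀ {a b r z c w} → r + z ≡ a → c + w ≡ b →
  fracGt w b z a ≡ fracGt r a c b
fracGt-complement {a} {b} {r} {z} {c} {w} r+z≡a c+w≡b = <ᵇ-cong (+-trade-< {r * b} {z * b} {c * a} {w * a} sums)
  where
  sums : r * b + z * b ≡ c * a + w * a
  sums = begin
    r * b + z * b  ≡⟨ *-distribʳ-+ b r z ⟨
    (r + z) * b    ≡⟨ cong (_* b) r+z≡a ⟩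
    a * b          ≡⟨ *-comm a b ⟩
    b * a          ≡⟨ cong (_* a) c+w≡b ⟨
    (c + w) * a    ≡⟨ *-distribʳ-+ a c w ⟩
    c * a + w * a  ∎

-- Complement s r z: r, z ∈ ⟨s-1⟩ and r + z ≡ 0 (mod s), in the explicit form
-- "both zero, or both positive summing to s".
data Complement (s : ℕ) : ℕ → ℕ → Set where
  both-zero : 0 < s → Complement s 0 0
  both-pos  : ∀ {r z} → 0 < r → 0 < z → r + z ≡ s → Complement s r z

negMod-complement : ∀ {r s} → r < s → Complement s r (negMod r s)
negMod-complement {zero} {suc k} _ =
  subst (Complement (suc k) 0) (sym (n%n≡0 (suc k))) (both-zero z<s)
negMod-complement {suc r} {suc k} r<s =
  subst (Complement (suc k) (suc r)) (sym negMod≡s∸r)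
    (both-pos z<s (m<n⇒0<n∸m r<s) (m+[n∸m]≡n (<⇒≤ r<s)))
  where
  negMod≡s∸r : negMod (suc r) (suc k) ≡ suc k ∸ suc r
  negMod≡s∸r rewrite m<n⇒m%n≡m r<s = m<n⇒m%n≡m (∸-monoʳ-< z<s (<⇒≤ r<s))

complement-positive : ∀ {s r z} → Complement s r z → fracGt r s 0 1 ≡ fracGt z s 0 1
complement-positive (both-zero _)                   = refl
complement-positive (both-pos (s≤s z≤n) (s≤s z≤n) _) = refl

exchange : ∀ {a b r z c w} → Complement a r z → Complement b c w →
  indicator (fracGt r a c b) + indicator (fracGt w b 0 1)
    ≡ indicator (fracGt z a 0 1) + indicator (fracGt w b z a)
exchange (both-zero _)         (both-zero _)                    = refl
exchange (both-zero (s≤s z≤n)) (both-pos _ (s≤s z≤n) _)         = refl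
exchange (both-pos (s≤s z≤n) (s≤s z≤n) _) (both-zero (s≤s z≤n)) = refl
exchange {a} {b} {r} {z} {c} {w}
         (both-pos _ (s≤s z≤n) r+z≡a) (both-pos _ (s≤s z≤n) c+w≡b) = begin
  indicator (fracGt r a c b) + 1  ≡⟨ +-comm _ 1 ⟩
  1 + indicator (fracGt r a c b)  ≡⟨ cong (λ g → 1 + indicator g) (fracGt-complement {a} {b} {r} {z} {c} {w} r+z≡a c+w≡b) ⟨
  1 + indicator (fracGt w b z a)  ∎

ascents : ∀ {m} → Vec ℕ m → Vec ℕ m → ℕ
ascents (t ∷ t′ ∷ ts) (r ∷ r′ ∷ rs) =
  indicator (fracGt r′ t′ r t) + ascents (t′ ∷ ts) (r′ ∷ rs)
ascents _ _ = 0

des-∷ʳ : ∀ {k} (ts rs : Vec ℕ k) t r t′ r′ →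
  des ((ts ∷ʳ t) ∷ʳ t′) ((rs ∷ʳ r) ∷ʳ r′)
    ≡ des (ts ∷ʳ t) (rs ∷ʳ r) + indicator (fracGt r t r′ t′)
des-∷ʳ [] [] t r t′ r′ = +-comm _ 0
des-∷ʳ (u ∷ []) (q ∷ []) t r t′ r′ =
  trans (cong (indicator (fracGt q u r t) +_) (des-∷ʳ [] [] t r t′ r′))
        (sym (+-assoc (indicator (fracGt q u r t)) _ _))
des-∷ʳ (u ∷ u′ ∷ ts) (q ∷ q′ ∷ rs) t r t′ r′ =
  trans (cong (indicator (fracGt q u q′ u′) +_) (des-∷ʳ (u′ ∷ ts) (q′ ∷ rs) t r t′ r′))
        (sym (+-assoc (indicator (fracGt q u q′ u′)) _ _))

des-reverse : ∀ {m} (ts rs : Vec ℕ m) → des (reverse ts) (reverse rs) ≡ ascents ts rs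
des-reverse [] [] = refl
des-reverse (t ∷ []) (r ∷ []) = refl
des-reverse (t ∷ t′ ∷ ts) (r ∷ r′ ∷ rs) = begin
  des (reverse (t ∷ t′ ∷ ts)) (reverse (r ∷ r′ ∷ rs))
    ≡⟨ cong₂ des (reverse-∷∷ t t′ ts) (reverse-∷∷ r r′ rs) ⟩
  des ((reverse ts ∷ʳ t′) ∷ʳ t) ((reverse rs ∷ʳ r′) ∷ʳ r)
    ≡⟨ des-∷ʳ (reverse ts) (reverse rs) t′ r′ t r ⟩
  des (reverse ts ∷ʳ t′) (reverse rs ∷ʳ r′) + indicator (fracGt r′ t′ r t)
    ≡⟨ cong (_+ indicator (fracGt r′ t′ r t)) (cong₂ des (reverse-∷ t′ ts) (reverse-∷ r′ rs)) ⟨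
  des (reverse (t′ ∷ ts)) (reverse (r′ ∷ rs)) + indicator (fracGt r′ t′ r t)
    ≡⟨ cong (_+ indicator (fracGt r′ t′ r t)) (des-reverse (t′ ∷ ts) (r′ ∷ rs)) ⟩
  ascents (t′ ∷ ts) (r′ ∷ rs) + indicator (fracGt r′ t′ r t)
    ≡⟨ +-comm _ (indicator (fracGt r′ t′ r t)) ⟩
  ascents (t ∷ t′ ∷ ts) (r ∷ r′ ∷ rs) ∎
  where
  reverse-∷∷ : ∀ {k} (x y : ℕ) (xs : Vec ℕ k) → reverse (x ∷ y ∷ xs) ≡ (reverse xs ∷ʳ y) ∷ʳ x
  reverse-∷∷ x y xs = trans (reverse-∷ x (y ∷ xs)) (cong (_∷ʳ x) (reverse-∷ y xs))

-- Summing the exchange identity: des_{s*}(r,0) equals the ascents of (1,s)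
-- against (0,Φ_s(r)).  Positivity of s is implied by r ∈ Ψ_n.
telescope : ∀ {n} (s r : Vec ℕ n) → InΨ s r →
  des (star s) (app0 r) ≡ ascents (1 ∷ s) (0 ∷ Φ s r)
telescope [] [] [] = refl
telescope (a ∷ []) (r ∷ []) (r<a ∷ []) =
  cong (λ g → indicator g + 0) (complement-positive (negMod-complement r<a))
telescope (a ∷ b ∷ s) (r ∷ c ∷ rs) (r<a ∷ c<b ∷ rs<s) = begin
  L + des (star (b ∷ s)) (app0 (c ∷ rs))  ≡⟨ cong (L +_) (telescope (b ∷ s) (c ∷ rs) (c<b ∷ rs<s)) ⟩
  L + (Pw + A)                            ≡⟨ +-assoc L Pw A ⟨
  (L + Pw) + A                            ≡⟨ cong (_+ A) (exchange (negMod-complement r<a) (negMod-complement c<b)) ⟩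
  (Pz + D) + A                            ≡⟨ +-assoc Pz D A ⟩
  Pz + (D + A)                            ∎
  where
  z = negMod r a
  w = negMod c b
  L  = indicator (fracGt r a c b)
  D  = indicator (fracGt w b z a)
  Pz = indicator (fracGt z a 0 1)
  Pw = indicator (fracGt w b 0 1)
  A  = ascents (b ∷ s) (w ∷ Φ s rs)

theorem5p8 : ∀ (n : ℕ) (s : Vec ℕ n) → Positive s →
    ∀ (r : Vec ℕ n) → InΨ s r →
    des (star s) (app0 r) ≡ des (star (reverse s)) (app0 (reverse (Φ s r)))
theorem5p8 n s _ r r∈Ψ = begin
  des (star s) (app0 r)                          ≡⟨ telescope s r r∈Ψ ⟩
  ascents (1 ∷ s) (0 ∷ Φ s r)                    ≡⟨ des-reverse (1 ∷ s) (0 ∷ Φ s r) ⟨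
  des (reverse (1 ∷ s)) (reverse (0 ∷ Φ s r))    ≡⟨ cong₂ des (reverse-∷ 1 s) (reverse-∷ 0 (Φ s r)) ⟩
  des (star (reverse s)) (app0 (reverse (Φ s r))) ∎
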